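{- Let $G$ be a finite simple graph on the vertex set $V$ with a dominating induced matching. Assume that there is a partition $V = W \sqcup M$, where $W = \{y_1, \ldots, y_r\}$ is an independent set of $G$ and the induced subgraph $G_M$ consists of $m$ pairwise disjoint edges $\{x_{j1}, x_{j2}\}$, $j = 1, \ldots, m$, such that for each $j = 1, \ldots, m$ one of the following holds: (i) $\deg_G x_{j1} = 1$ or $\deg_G x_{j2} = 1$; (ii) $\deg_G x_{j1} = \deg_G x_{j2} = 2$ and there is $y_{i_j} \in W$ with $x_{j1}, x_{j2} \in N_G(y_{i_j})$; (iii) for $\{k, l\} = \{1, 2\}$, $\deg_G x_{jk} = 3$, $\deg_G x_{jl} = 2$, and there is $y_{i_j} \in W$ with $N_G(y_{i_j}) = \{x_{j1}, x_{j2}\}$; (iv) $\deg_G x_{j1} = \deg_G x_{j2} = 3$ and there are three distinct vertices $y_{i_{j1}}, y_{i_{j2}}, y_{i_{j3}} \in W$ such that $\{x_{j1}, y_{i_{j1}}\}, \{x_{j2}, y_{i_{j2}}\} \in E(G)$, $N_G(y_{i_{j3}}) = \{x_{j1}, x_{j2}\}$, and there is a pendant triangle attached to at least one of $y_{i_{j1}}, y_{i_{j2}}$. Then $G$ is vertex decomposable.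
   Context: All graphs are finite and simple. A matching is a set of pairwise disjoint edges; it is maximal if no further edge can be added. An induced matching is a matching such that no edge of $G$ meets two distinct edges of the matching; a dominating induced matching is an induced matching which is also a maximal matching. $G_U$ is the induced subgraph on $U$, $G \setminus U = G_{V \setminus U}$, $G \setminus v = G \setminus \{v\}$. $N_G(x)$ is the set of neighbours of $x$, $N_G[x] = N_G(x) \cup \{x\}$, $\deg_G x = \# N_G(x)$. A set of vertices is independent if no two of its vertices are adjacent. A pendant triangle attached to a vertex $v$ is a triangle of $G$ containing $v$ whose two other vertices have degree $2$ in $G$, while $v$ has degree greater than $2$. $G$ is vertex decomposable if $G$ has no edges, or there is a vertex $v$ such that (VD1) $G \setminus v$ and $G \setminus N_G[v]$ are vertex decomposable, and (VD2) no independent set of $G \setminus N_G[v]$ is a maximal independent set of $G \setminus v$. -}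

module Defs where

open import Level using (0ℓ)
open import Data.Nat using (ℕ; suc; _>_)
open import Data.Fin using (Fin)
open import Data.List using (List; length; filter; allFin)
open import Data.Product using (Σ; ∃; ∃-syntax; _×_; _,_)
open import Data.Sum using (_⊎_)
open import Data.Empty using (⊥)
open import Relation.Nullary using (¬_)
open import Relation.Unary using (Pred; _⊆_)
open import Relation.Binary using (Decidable)
open import Relation.Binary.PropositionalEquality using (_≡_; _≢_)

record Graph (n : ℕ) : Set₁ where
  field
    E      : Fin n → Fin n → Set
    E?     : Decidable E
    E-sym  : ∀ {a b} → E a b → E b a
    E-irr  : ∀ {a} → ¬ E a a
open Graph public

deg : ∀ {n} → Graph n → Fin n → ℕ
deg {n} G x = length (filter (E? G x) (allFin n))

VSet : ℕ → Set₁
VSet n = Pred (Fin n) 0ℓ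

Meets : ∀ {n} → Fin n × Fin n → Fin n × Fin n → Set
Meets (a , b) (c , d) = (a ≡ c ⊎ a ≡ d) ⊎ (b ≡ c ⊎ b ≡ d)

IsMatching : ∀ {n} (G : Graph n) {k : ℕ} → (Fin k → Fin n × Fin n) → Set
IsMatching G {k} e =
  (∀ i → let (a , b) = e i in E G a b) ×
  (∀ i j → i ≢ j → ¬ Meets (e i) (e j))

IsInducedMatching : ∀ {n} (G : Graph n) {k : ℕ} → (Fin k → Fin n × Fin n) → Set
IsInducedMatching G {k} e =
  IsMatching G e ×
  (∀ a b → E G a b → ∀ i j → i ≢ j → Meets (a , b) (e i) → Meets (a , b) (e j) → ⊥)

-- maximal: no further edge of G can be added, i.e. every edge of G meets an edge of the matching
IsMaximalMatching : ∀ {n} (G : Graph n) {k : ℕ} → (Fin k → Fin n × Fin n) → Set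
IsMaximalMatching G {k} e =
  IsMatching G e × (∀ a b → E G a b → ∃[ i ] Meets (a , b) (e i))

HasDominatingInducedMatching : ∀ {n} → Graph n → Set
HasDominatingInducedMatching {n} G =
  ∃[ k ] Σ (Fin k → Fin n × Fin n) λ e → IsInducedMatching G e × IsMaximalMatching G e

Independent : ∀ {n} → Graph n → VSet n → VSet n → Set
Independent G U S = S ⊆ U × (∀ a b → S a → S b → ¬ E G a b)

MaximalIndependent : ∀ {n} → Graph n → VSet n → VSet n → Set₁
MaximalIndependent G U S =
  Independent G U S × (∀ S' → Independent G U S' → S ⊆ S' → S' ⊆ S)

del : ∀ {n} → VSet n → Fin n → VSet n
del U v x = U x × x ≢ v

delN : ∀ {n} → Graph n → VSet n → Fin n → VSet n
delN G U v x = U x × x ≢ v × ¬ E G v x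

-- The induced subgraph G_U is vertex decomposable.
data VD {n} (G : Graph n) : VSet n → Set₁ where
  vd-noEdges : ∀ {U} → (∀ a b → U a → U b → ¬ E G a b) → VD G U
  vd-step    : ∀ {U} (v : Fin n) → U v →
               VD G (del U v) → VD G (delN G U v) →
               (∀ S → Independent G (delN G U v) S → ¬ MaximalIndependent G (del U v) S) →
               VD G U

VertexDecomposable : ∀ {n} → Graph n → Set₁
VertexDecomposable G = VD G (λ _ → Data.Unit.⊤)
  where import Data.Unit

NbhdIs : ∀ {n} → Graph n → Fin n → Fin n → Fin n → Set
NbhdIs G v a b = ∀ w → (E G v w → w ≡ a ⊎ w ≡ b) × (w ≡ a ⊎ w ≡ b → E G v w)

PendantTriangle : ∀ {n} → Graph n → Fin n → Set
PendantTriangle G v =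
  ∃[ a ] ∃[ b ] (E G v a × E G v b × E G a b × deg G a ≡ 2 × deg G b ≡ 2 × deg G v > 2)

-- Every edge of G has an endpoint in the closed neighbourhood N[s] of a simplicial vertex s
-- (one whose neighbours are pairwise adjacent): every edge meets M since W is independent, and
-- for each matched edge x_{j1}x_{j2} the vertex of degree 1 (case i), the vertex x_{j1} of
-- degree 2 (case ii), or the vertex y with N(y) = {x_{j1}, x_{j2}} (cases iii, iv) is
-- simplicial with both ends in its closed neighbourhood.
-- A neighbour v of a simplicial vertex s is a shedding vertex, since s extends every independent
-- set avoiding N[v]. The covering property passes to G ∖ v and to G ∖ N[v]: simplicial vertices
-- stay simplicial in induced subgraphs, and if the simplicial s′ covering a vertex is removed as
-- v, then s is adjacent to s′ and hence to, or equal to, each neighbour of s′. Induction on the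
-- number of vertices then shows that G is vertex decomposable.
module Submission where

open import Defs
open import Data.Nat using (ℕ; suc; _≤_; _<_; z≤n; s≤s)
open import Data.Nat.Induction using (<-wellFounded)
open import Data.Nat.Properties using (≤-trans; n≤1+n)
open import Data.Fin using (Fin; zero; suc; _≟_)
open import Data.Fin.Properties using (any?)
open import Data.List using (List; length; filter; allFin)
open import Data.List.Properties using (filter-notAll)
open import Data.List.Membership.Propositional using (_∈_)
open import Data.List.Membership.Propositional.Properties using (∈-filter⁺; ∈-allFin)
open import Data.List.Relation.Unary.Any using (here; there)
import Data.List.Relation.Unary.Any as Any
open import Data.Unit using (⊤; tt)
open import Data.Empty using (⊥-elim)
open import Data.Product using (∃-syntax; _×_; _,_; proj₁; proj₂; swap)
open import Function using (_∘′_)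
open import Data.Sum using (_⊎_; inj₁; inj₂; [_,_])
import Data.Sum as Sum
open import Induction.WellFounded using (Acc; acc)
open import Relation.Nullary using (¬_; Dec; yes; no)
open import Relation.Nullary.Decidable using (¬?; _×-dec_)
open import Relation.Unary using (Decidable; _⊆_) renaming (U to Everything)
open import Relation.Binary.PropositionalEquality using (_≡_; _≢_; refl; sym; trans; subst)

∈⇒1≤length : ∀ {A : Set} {a : A} {xs} → a ∈ xs → 1 ≤ length xs
∈⇒1≤length (here _)  = s≤s z≤n
∈⇒1≤length (there _) = s≤s z≤n

distinct-∈⇒2≤length : ∀ {A : Set} {a b : A} {xs} → a ≢ b → a ∈ xs → b ∈ xs → 2 ≤ length xs
distinct-∈⇒2≤length a≢b (here refl) (here refl) = ⊥-elim (a≢b refl)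
distinct-∈⇒2≤length a≢b (here _)    (there b∈) = s≤s (∈⇒1≤length b∈)
distinct-∈⇒2≤length a≢b (there a∈)  (here _)   = s≤s (∈⇒1≤length a∈)
distinct-∈⇒2≤length a≢b (there a∈)  (there b∈) = ≤-trans (distinct-∈⇒2≤length a≢b a∈ b∈) (n≤1+n _)

distinct-∈⇒3≤length : ∀ {A : Set} {a b c : A} {xs} → a ≢ b → a ≢ c → b ≢ c →
                      a ∈ xs → b ∈ xs → c ∈ xs → 3 ≤ length xs
distinct-∈⇒3≤length a≢b a≢c b≢c (here refl) (here refl) _          = ⊥-elim (a≢b refl)
distinct-∈⇒3≤length a≢b a≢c b≢c (here refl) (there _)   (here refl) = ⊥-elim (a≢c refl)
distinct-∈⇒3≤length a≢b a≢c b≢c (here _)    (there b∈)  (there c∈)  = s≤s (distinct-∈⇒2≤length b≢c b∈ c∈)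
distinct-∈⇒3≤length a≢b a≢c b≢c (there _)   (here refl) (here refl) = ⊥-elim (b≢c refl)
distinct-∈⇒3≤length a≢b a≢c b≢c (there a∈)  (here _)    (there c∈)  = s≤s (distinct-∈⇒2≤length a≢c a∈ c∈)
distinct-∈⇒3≤length a≢b a≢c b≢c (there a∈)  (there b∈)  (here _)    = s≤s (distinct-∈⇒2≤length a≢b a∈ b∈)
distinct-∈⇒3≤length a≢b a≢c b≢c (there a∈)  (there b∈)  (there c∈)  =
  ≤-trans (distinct-∈⇒3≤length a≢b a≢c b≢c a∈ b∈ c∈) (n≤1+n _)

module _ {n} (G : Graph n) where

  adjacent⇒≢ : ∀ {a b} → E G a b → a ≢ b
  adjacent⇒≢ e refl = E-irr G e

  adjacent⇒∈neighbours : ∀ {a b} → E G a b → b ∈ filter (E? G a) (allFin n)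
  adjacent⇒∈neighbours {b = b} e = ∈-filter⁺ (E? G _) (∈-allFin b) e

  deg≡1⇒neighbour-unique : ∀ {a b c} → deg G a ≡ 1 → E G a b → E G a c → c ≡ b
  deg≡1⇒neighbour-unique {b = b} {c} d eb ec with c ≟ b
  ... | yes c≡b = c≡b
  ... | no  c≢b = ⊥-elim (2≰1 (subst (2 ≤_) d
          (distinct-∈⇒2≤length c≢b (adjacent⇒∈neighbours ec) (adjacent⇒∈neighbours eb))))
    where
      2≰1 : ¬ 2 ≤ 1
      2≰1 (s≤s ())

  deg≡2⇒neighbours : ∀ {a b c d} → deg G a ≡ 2 → E G a b → E G a c → b ≢ c →
                     E G a d → d ≡ b ⊎ d ≡ c
  deg≡2⇒neighbours {b = b} {c} {d} deg≡2 eb ec b≢c ed with d ≟ b | d ≟ c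
  ... | yes d≡b | _       = inj₁ d≡b
  ... | no _    | yes d≡c = inj₂ d≡c
  ... | no d≢b  | no d≢c  = ⊥-elim (3≰2 (subst (3 ≤_) deg≡2
          (distinct-∈⇒3≤length b≢c (λ b≡d → d≢b (sym b≡d)) (λ c≡d → d≢c (sym c≡d))
            (adjacent⇒∈neighbours eb) (adjacent⇒∈neighbours ec) (adjacent⇒∈neighbours ed))))
    where
      3≰2 : ¬ 3 ≤ 2
      3≰2 (s≤s (s≤s ()))

  Simplicial : VSet n → Fin n → Set
  Simplicial U s = U s × (∀ a b → U a → U b → E G s a → E G s b → a ≡ b ⊎ E G a b)

  InSimplicialClosedNbhd : VSet n → Fin n → Set
  InSimplicialClosedNbhd U a = ∃[ s ] (Simplicial U s × (a ≡ s ⊎ E G s a))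

  EdgesMeetSimplicialNbhds : VSet n → Set
  EdgesMeetSimplicialNbhds U =
    ∀ a b → U a → U b → E G a b → InSimplicialClosedNbhd U a ⊎ InSimplicialClosedNbhd U b

  simplicial-restrict : ∀ {U U′ s} → U′ ⊆ U → U′ s → Simplicial U s → Simplicial U′ s
  simplicial-restrict U′⊆U u′s (_ , clique) = u′s , λ a b u′a u′b → clique a b (U′⊆U u′a) (U′⊆U u′b)

  simplicial-neighbour-is-shedding : ∀ {U v s} → U v → Simplicial U s → E G s v →
    ∀ S → Independent G (delN G U v) S → ¬ MaximalIndependent G (del U v) S
  simplicial-neighbour-is-shedding {U} {v} {s} uv (us , clique) esv S (S⊆ , S-ind) (_ , maximal) =
    proj₂ (proj₂ (S⊆ s∈S)) (E-sym G esv)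
    where
      S+s : VSet n
      S+s x = S x ⊎ x ≡ s

      s-not-adjacent-to-S : ∀ a → S a → ¬ E G a s
      s-not-adjacent-to-S a sa eas with S⊆ sa
      ... | ua , a≢v , ¬eva with clique a v ua uv (E-sym G eas) esv
      ...   | inj₁ a≡v = a≢v a≡v
      ...   | inj₂ eav = ¬eva (E-sym G eav)

      S+s⊆U∖v : S+s ⊆ del U v
      S+s⊆U∖v (inj₁ sx)   = let (ux , x≢v , _) = S⊆ sx in ux , x≢v
      S+s⊆U∖v (inj₂ refl) = us , adjacent⇒≢ esv

      S+s-independent : ∀ a b → S+s a → S+s b → ¬ E G a b
      S+s-independent a b (inj₁ sa)   (inj₁ sb)   = S-ind a b sa sb
      S+s-independent a b (inj₁ sa)   (inj₂ refl) = s-not-adjacent-to-S a sa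
      S+s-independent a b (inj₂ refl) (inj₁ sb)   = λ e → s-not-adjacent-to-S b sb (E-sym G e)
      S+s-independent a b (inj₂ refl) (inj₂ refl) = E-irr G

      s∈S : S s
      s∈S = maximal S+s (S+s⊆U∖v , S+s-independent) inj₁ (inj₂ refl)

  inSimplicialClosedNbhd-del : ∀ {U v s} → Simplicial U s → E G s v →
    ∀ {a} → del U v a → InSimplicialClosedNbhd U a → InSimplicialClosedNbhd (del U v) a
  inSimplicialClosedNbhd-del {v = v} {s} (us , clique) esv {a} (ua , a≢v) (s′ , s′-simp , near)
    with s′ ≟ v
  ... | no s′≢v = s′ , simplicial-restrict proj₁ (proj₁ s′-simp , s′≢v) s′-simp , near
  ... | yes refl with near
  ...   | inj₁ a≡v = ⊥-elim (a≢v a≡v)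
  ...   | inj₂ eva =
            s , simplicial-restrict proj₁ (us , adjacent⇒≢ esv) (us , clique) ,
            Sum.map₁ sym (proj₂ s′-simp s a us ua (E-sym G esv) eva)

  inSimplicialClosedNbhd-delN : ∀ {U v} → U v →
    ∀ {a} → delN G U v a → InSimplicialClosedNbhd U a → InSimplicialClosedNbhd (delN G U v) a
  inSimplicialClosedNbhd-delN {v = v} uv {a} (ua , a≢v , ¬eva) (s′ , s′-simp , near) with s′ ≟ v
  ... | yes refl = ⊥-elim ([ a≢v , ¬eva ] near)
  ... | no s′≢v with E? G v s′
  ...   | no ¬evs′ = s′ , simplicial-restrict proj₁ (proj₁ s′-simp , s′≢v , ¬evs′) s′-simp , near
  ...   | yes evs′ with near
  ...     | inj₁ refl = ⊥-elim (¬eva evs′)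
  ...     | inj₂ es′a = ⊥-elim ([ a≢v , (λ eav → ¬eva (E-sym G eav)) ]
                                  (proj₂ s′-simp a v ua uv es′a (E-sym G evs′)))

  edgesMeetSimplicialNbhds-del : ∀ {U v s} → Simplicial U s → E G s v →
    EdgesMeetSimplicialNbhds U → EdgesMeetSimplicialNbhds (del U v)
  edgesMeetSimplicialNbhds-del s-simp esv covered a b ua ub e =
    Sum.map (inSimplicialClosedNbhd-del s-simp esv ua) (inSimplicialClosedNbhd-del s-simp esv ub)
            (covered a b (proj₁ ua) (proj₁ ub) e)

  edgesMeetSimplicialNbhds-delN : ∀ {U v} → U v →
    EdgesMeetSimplicialNbhds U → EdgesMeetSimplicialNbhds (delN G U v)
  edgesMeetSimplicialNbhds-delN uv covered a b ua ub e =
    Sum.map (inSimplicialClosedNbhd-delN uv ua) (inSimplicialClosedNbhd-delN uv ub)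
            (covered a b (proj₁ ua) (proj₁ ub) e)

  simplicial-with-neighbour : ∀ {U a b} → U a → U b → E G a b → InSimplicialClosedNbhd U a →
                              ∃[ s ] ∃[ v ] (Simplicial U s × E G s v × U v)
  simplicial-with-neighbour ua ub eab (s , s-simp , inj₁ refl) = s , _ , s-simp , eab , ub
  simplicial-with-neighbour ua ub eab (s , s-simp , inj₂ esa)  = s , _ , s-simp , esa , ua

  edgesMeetSimplicialNbhds⇒VD : ∀ (U : VSet n) → Decidable U → (L : List (Fin n)) → U ⊆ (_∈ L) →
    Acc _<_ (length L) → EdgesMeetSimplicialNbhds U → VD G U
  edgesMeetSimplicialNbhds⇒VD U U? L U⊆L (acc smaller) covered
    with any? (λ a → any? (λ b → U? a ×-dec U? b ×-dec E? G a b))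
  ... | no noEdge = vd-noEdges (λ a b ua ub e → noEdge (a , b , ua , ub , e))
  ... | yes (a , b , ua , ub , e) =
    shed ([ simplicial-with-neighbour ua ub e , simplicial-with-neighbour ub ua (E-sym G e) ]
            (covered a b ua ub e))
    where
      shed : ∃[ s ] ∃[ v ] (Simplicial U s × E G s v × U v) → VD G U
      shed (s , v , s-simp , esv , uv) =
        vd-step v uv
          (edgesMeetSimplicialNbhds⇒VD (del U v) (λ x → U? x ×-dec ≢v? x) L∖v
             (λ (ux , x≢v) → ∈-filter⁺ ≢v? (U⊆L ux) x≢v) (smaller shorter)
             (edgesMeetSimplicialNbhds-del s-simp esv covered))
          (edgesMeetSimplicialNbhds⇒VD (delN G U v) (λ x → U? x ×-dec ≢v? x ×-dec ¬? (E? G v x)) L∖v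
             (λ (ux , x≢v , _) → ∈-filter⁺ ≢v? (U⊆L ux) x≢v) (smaller shorter)
             (edgesMeetSimplicialNbhds-delN uv covered))
          (simplicial-neighbour-is-shedding uv s-simp esv)
        where
          ≢v? : (x : Fin n) → Dec (x ≢ v)
          ≢v? x = ¬? (x ≟ v)
          L∖v : List (Fin n)
          L∖v = filter ≢v? L
          shorter : length L∖v < length L
          shorter = filter-notAll ≢v? L (Any.map (λ v≡x x≢v → x≢v (sym v≡x)) (U⊆L uv))

  edgesMeetSimplicialNbhds⇒vertexDecomposable :
    EdgesMeetSimplicialNbhds Everything → VertexDecomposable G
  edgesMeetSimplicialNbhds⇒vertexDecomposable =
    edgesMeetSimplicialNbhds⇒VD Everything (λ _ → yes tt) (allFin n) (λ {x} _ → ∈-allFin x)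
      (<-wellFounded _)

  EndsInSimplicialClosedNbhds : Fin n → Fin n → Set
  EndsInSimplicialClosedNbhds a b =
    InSimplicialClosedNbhd Everything a × InSimplicialClosedNbhd Everything b

  simplicial-if-neighbours⊆edge : ∀ {s p q} → E G p q → (∀ w → E G s w → w ≡ p ⊎ w ≡ q) →
                                  Simplicial Everything s
  simplicial-if-neighbours⊆edge {s} {p} {q} epq nbhd = tt , clique
    where
      clique : ∀ a b → ⊤ → ⊤ → E G s a → E G s b → a ≡ b ⊎ E G a b
      clique a b _ _ esa esb with nbhd a esa | nbhd b esb
      ... | inj₁ refl | inj₁ refl = inj₁ refl
      ... | inj₁ refl | inj₂ refl = inj₂ epq
      ... | inj₂ refl | inj₁ refl = inj₂ (E-sym G epq)
      ... | inj₂ refl | inj₂ refl = inj₁ refl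

  endsInSimplicialClosedNbhds-if-deg≡1 : ∀ {a b} → deg G a ≡ 1 → E G a b →
                                         EndsInSimplicialClosedNbhds a b
  endsInSimplicialClosedNbhds-if-deg≡1 {a} deg≡1 eab =
    (a , a-simp , inj₁ refl) , (a , a-simp , inj₂ eab)
    where
      a-simp : Simplicial Everything a
      a-simp = tt , λ c d _ _ eac ead →
        inj₁ (trans (deg≡1⇒neighbour-unique deg≡1 eab eac) (sym (deg≡1⇒neighbour-unique deg≡1 eab ead)))

  endsInSimplicialClosedNbhds-if-deg≡2-triangle : ∀ {a b c} → deg G a ≡ 2 → E G a b →
    E G c a → E G c b → c ≢ b → EndsInSimplicialClosedNbhds a b
  endsInSimplicialClosedNbhds-if-deg≡2-triangle {a} deg≡2 eab eca ecb c≢b =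
    (a , a-simp , inj₁ refl) , (a , a-simp , inj₂ eab)
    where
      a-simp : Simplicial Everything a
      a-simp = simplicial-if-neighbours⊆edge ecb
        (λ w → Sum.swap ∘′ deg≡2⇒neighbours deg≡2 eab (E-sym G eca) (λ b≡c → c≢b (sym b≡c)))

  endsInSimplicialClosedNbhds-if-neighbourhood≡edge : ∀ {s a b} → NbhdIs G s a b → E G a b →
                                                      EndsInSimplicialClosedNbhds a b
  endsInSimplicialClosedNbhds-if-neighbourhood≡edge {s} nbhd eab =
    (s , s-simp , inj₂ (proj₂ (nbhd _) (inj₁ refl))) , (s , s-simp , inj₂ (proj₂ (nbhd _) (inj₂ refl)))
    where
      s-simp : Simplicial Everything s
      s-simp = simplicial-if-neighbours⊆edge eab (λ w → proj₁ (nbhd w))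

theorem3p1 : ∀ {n} (G : Graph n) → HasDominatingInducedMatching G →
  (r m : ℕ) (y : Fin r → Fin n) (x : Fin m → Fin 2 → Fin n) →
  (∀ i i' → y i ≡ y i' → i ≡ i') →
  (∀ j k j' k' → x j k ≡ x j' k' → j ≡ j' × k ≡ k') →
  (∀ i j k → y i ≢ x j k) →
  (∀ v → (∃[ i ] y i ≡ v) ⊎ (∃[ j ] ∃[ k ] x j k ≡ v)) →
  (∀ i i' → ¬ E G (y i) (y i')) →
  (∀ j → E G (x j zero) (x j (suc zero))) →
  (∀ j k j' k' → E G (x j k) (x j' k') → j ≡ j') →
  (∀ j →
    (deg G (x j zero) ≡ 1 ⊎ deg G (x j (suc zero)) ≡ 1)
    ⊎ (deg G (x j zero) ≡ 2 × deg G (x j (suc zero)) ≡ 2 ×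
       ∃[ i ] (E G (y i) (x j zero) × E G (y i) (x j (suc zero))))
    ⊎ (∃[ k ] ∃[ l ] (k ≢ l × deg G (x j k) ≡ 3 × deg G (x j l) ≡ 2 ×
       ∃[ i ] NbhdIs G (y i) (x j zero) (x j (suc zero))))
    ⊎ (deg G (x j zero) ≡ 3 × deg G (x j (suc zero)) ≡ 3 ×
       ∃[ i₁ ] ∃[ i₂ ] ∃[ i₃ ] (i₁ ≢ i₂ × i₁ ≢ i₃ × i₂ ≢ i₃ ×
         E G (x j zero) (y i₁) × E G (x j (suc zero)) (y i₂) ×
         NbhdIs G (y i₃) (x j zero) (x j (suc zero)) ×
         (PendantTriangle G (y i₁) ⊎ PendantTriangle G (y i₂))))) →
  VertexDecomposable G
theorem3p1 G _ _ _ y x _ _ y≢x partition W-independent x-edge _ cases =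
  edgesMeetSimplicialNbhds⇒vertexDecomposable G edgesCovered
  where
    matchedEdgeCovered : ∀ j → EndsInSimplicialClosedNbhds G (x j zero) (x j (suc zero))
    matchedEdgeCovered j with cases j
    ... | inj₁ (inj₁ deg≡1) = endsInSimplicialClosedNbhds-if-deg≡1 G deg≡1 (x-edge j)
    ... | inj₁ (inj₂ deg≡1) =
      swap (endsInSimplicialClosedNbhds-if-deg≡1 G deg≡1 (E-sym G (x-edge j)))
    ... | inj₂ (inj₁ (deg≡2 , _ , i , e₀ , e₁)) =
      endsInSimplicialClosedNbhds-if-deg≡2-triangle G deg≡2 (x-edge j) e₀ e₁ (y≢x i j (suc zero))
    ... | inj₂ (inj₂ (inj₁ (_ , _ , _ , _ , _ , _ , nbhd))) =
      endsInSimplicialClosedNbhds-if-neighbourhood≡edge G nbhd (x-edge j)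
    ... | inj₂ (inj₂ (inj₂ (_ , _ , _ , _ , _ , _ , _ , _ , _ , _ , nbhd , _))) =
      endsInSimplicialClosedNbhds-if-neighbourhood≡edge G nbhd (x-edge j)

    matchedVertexCovered : ∀ j k → InSimplicialClosedNbhd G Everything (x j k)
    matchedVertexCovered j zero       = proj₁ (matchedEdgeCovered j)
    matchedVertexCovered j (suc zero) = proj₂ (matchedEdgeCovered j)

    edgesCovered : EdgesMeetSimplicialNbhds G Everything
    edgesCovered a b _ _ eab with partition a | partition b
    ... | inj₂ (j , k , refl) | _                   = inj₁ (matchedVertexCovered j k)
    ... | inj₁ _              | inj₂ (j , k , refl) = inj₂ (matchedVertexCovered j k)
    ... | inj₁ (i , refl)     | inj₁ (i′ , refl)    = ⊥-elim (W-independent i i′ eab)
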